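{- Let $T_1,T_2$ be two trees on the same label set $\mathcal{X}$. Then the minimum size of a leaf-disagreement for $\{T_1,T_2\}$ equals $d_{LR}(T_1,T_2)$. Moreover, the optimal (minimum-size) leaf-disagreements $(\mathcal{X}'_1,\mathcal{X}'_2)$ for $\{T_1,T_2\}$ are obtained as follows: for every set $\mathcal{X}'\subseteq\mathcal{X}$ with $|\mathcal{X}'|=d_{LR}(T_1,T_2)$ and $T_1-\mathcal{X}'=T_2-\mathcal{X}'$, partition $\mathcal{X}'$ into two disjoint sets $\mathcal{X}'_1,\mathcal{X}'_2$ with $\mathcal{X}'_1\cup\mathcal{X}'_2=\mathcal{X}'$; every optimal leaf-disagreement arises in this way.
   Context: All trees are rooted binary phylogenetic trees: rooted trees in which every non-leaf node has exactly two children, whose leaves are bijectively labeled by a finite label set $\mathcal{X}(T)$; two trees are equal if there is a label-preserving isomorphism between them. For $L\subseteq\mathcal{X}(T)$, $T-L$ is the tree obtained from $T$ by removing every leaf labeled by an element of $L$, contracting the resulting non-root vertices of degree two, and repeatedly deleting the root while it has degree one. The restriction $T|_L$ is $T-(\mathcal{X}(T)\setminus L)$. For two trees $T_1,T_2$ on the same label set $\mathcal{X}$, $d_{LR}(T_1,T_2)=\min\{|X| : X\subseteq\mathcal{X},\ T_1-X=T_2-X\}$. A set of trees $\{T_1,\ldots,T_t\}$ is compatible if there is a tree $T$ with $\mathcal{X}(T)=\bigcup_i\mathcal{X}(T_i)$ and $T|_{\mathcal{X}(T_i)}=T_i$ for every $i$. A pair $(\mathcal{X}_1,\mathcal{X}_2)$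 of subsets of $\mathcal{X}$ is a leaf-disagreement for $\{T_1,T_2\}$ if $\{T_1-\mathcal{X}_1,T_2-\mathcal{X}_2\}$ is compatible; its size is $|\mathcal{X}_1|+|\mathcal{X}_2|$. -}

module Defs where

open import Data.Nat using (ℕ; _+_; _≤_)
open import Data.Nat.Properties using (_≟_)
open import Data.List using (List; []; _∷_; _++_; length; filter)
open import Data.List.Relation.Unary.All using (All)
open import Data.List.Relation.Unary.Unique.Propositional using (Unique)
open import Data.List.Membership.Propositional using (_∈_; _∉_)
open import Data.List.Membership.DecPropositional _≟_ using (_∈?_)
open import Data.Maybe using (Maybe; just; nothing)
open import Data.Product using (Σ; _×_; _,_)
open import Data.Sum using (_⊎_)
open import Data.Unit using (⊤)
open import Data.Empty using (⊥)
open import Data.Bool using (if_then_else_)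
open import Relation.Nullary using (¬_; ¬?; does)
open import Function.Bundles using (_⇔_)
open import Relation.Binary.PropositionalEquality using (_≡_)

data Tree : Set where
  leaf : ℕ → Tree
  node : Tree → Tree → Tree

-- Possibly empty trees (removing all leaves yields the empty tree).
MTree : Set
MTree = Maybe Tree

labels : Tree → List ℕ
labels (leaf x)   = x ∷ []
labels (node l r) = labels l ++ labels r

mlabels : MTree → List ℕ
mlabels nothing  = []
mlabels (just t) = labels t

-- Leaves are bijectively labelled: no label occurs twice.
Phylo : MTree → Set
Phylo t = Unique (mlabels t)

-- Equality of trees: label-preserving isomorphism (children are unordered).
_≅_ : Tree → Tree → Set
leaf x   ≅ leaf y     = x ≡ y
leaf x   ≅ node _ _   = ⊥
node _ _ ≅ leaf _     = ⊥
node l r ≅ node l' r' = (l ≅ l' × r ≅ r') ⊎ (l ≅ r' × r ≅ l')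

_≅ᴹ_ : MTree → MTree → Set
nothing ≅ᴹ nothing = ⊤
nothing ≅ᴹ just _  = ⊥
just _  ≅ᴹ nothing = ⊥
just s  ≅ᴹ just t  = s ≅ t

-- T - L : remove leaves with labels in L, suppress degree-two vertices,
-- and delete a degree-one root.
_─_ : MTree → List ℕ → MTree
nothing         ─ L = nothing
just (leaf x)   ─ L = if does (x ∈? L) then nothing else just (leaf x)
just (node l r) ─ L with just l ─ L | just r ─ L
... | nothing | m       = m
... | just l' | nothing = just l'
... | just l' | just r' = just (node l' r')

_∣_ : MTree → List ℕ → MTree
T ∣ L = T ─ filter (λ x → ¬? (x ∈? L)) (mlabels T)

SubsetOf : List ℕ → MTree → Set
SubsetOf X T = Unique X × All (_∈ mlabels T) X

SameLabels : MTree → MTree → Set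
SameLabels A B = ∀ x → (x ∈ mlabels A) ⇔ (x ∈ mlabels B)

Compatible : MTree → MTree → Set
Compatible A B = Σ MTree λ T →
  Phylo T
  × (∀ x → (x ∈ mlabels T) ⇔ (x ∈ mlabels A ⊎ x ∈ mlabels B))
  × ((T ∣ mlabels A) ≅ᴹ A)
  × ((T ∣ mlabels B) ≅ᴹ B)

AgreementSet : MTree → MTree → List ℕ → Set
AgreementSet T₁ T₂ X = SubsetOf X T₁ × ((T₁ ─ X) ≅ᴹ (T₂ ─ X))

IsDLR : MTree → MTree → ℕ → Set
IsDLR T₁ T₂ d =
  (Σ (List ℕ) λ X → AgreementSet T₁ T₂ X × length X ≡ d)
  × (∀ X → AgreementSet T₁ T₂ X → d ≤ length X)

LeafDisagreement : MTree → MTree → List ℕ → List ℕ → Set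
LeafDisagreement T₁ T₂ X₁ X₂ =
  SubsetOf X₁ T₁ × SubsetOf X₂ T₁ × Compatible (T₁ ─ X₁) (T₂ ─ X₂)

ldSize : List ℕ → List ℕ → ℕ
ldSize X₁ X₂ = length X₁ + length X₂

OptimalLD : MTree → MTree → List ℕ → List ℕ → Set
OptimalLD T₁ T₂ X₁ X₂ =
  LeafDisagreement T₁ T₂ X₁ X₂
  × (∀ Y₁ Y₂ → LeafDisagreement T₁ T₂ Y₁ Y₂ → ldSize X₁ X₂ ≤ ldSize Y₁ Y₂)

PartitionOf : List ℕ → List ℕ → List ℕ → Set
PartitionOf X' X₁ X₂ =
  Unique X₁ × Unique X₂
  × (∀ x → x ∈ X₁ → x ∉ X₂)
  × (∀ x → (x ∈ X') ⇔ (x ∈ X₁ ⊎ x ∈ X₂))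

module Submission where

-- A leaf-disagreement (X₁, X₂) and an agreement set X′ = X₁ ∪ X₂ are two
-- views of the same object:
--   * if X′ is an agreement set (T₁ - X′ = T₂ - X′) and X′ = X₁ ∪ X₂, then
--     T₁ - X₁ and T₂ - X₂ agree on their common labels, and two rooted
--     trees that agree on their common labels are compatible
--     (amalgamation, the main technical construction);
--   * conversely, if T₁ - X₁ and T₂ - X₂ are compatible, restricting the
--     common supertree shows (T₁ - X₁) - X₂ = (T₂ - X₂) - X₁, i.e. X₁ ∪ X₂
--     is an agreement set.
-- Hence leaf-disagreements have size ≥ |X₁ ∪ X₂| ≥ d_LR, the bound is
-- attained by (X′, ∅), and counting shows that optimal ones are exactly the
-- partitions of minimum agreement sets.

open import Defs
open import Data.Nat using (ℕ; _+_; _≤_; _<_; s≤s; z≤n)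
open import Data.Nat.Properties using (_≟_; ≤-trans; ≤-reflexive; ≤-antisym; <-irrefl; <-≤-trans; +-identityʳ; +-monoʳ-≤; +-monoʳ-<; module ≤-Reasoning)
open import Data.Bool using (Bool; true; false; _∨_; if_then_else_)
open import Data.Bool.Properties using (∨-comm)
open import Data.List using (List; []; _∷_; _++_; length; filter)
open import Data.List.Properties using (length-++; length-filter; filter-notAll; length-++-sucʳ)
open import Data.List.Relation.Unary.All as All using (All)
open import Data.List.Relation.Unary.All.Properties using (++⁻ˡ)
open import Data.List.Relation.Unary.Any as Any using (here; there)
open import Data.List.Relation.Unary.AllPairs using ([]; _∷_)
open import Data.List.Relation.Unary.Unique.Propositional using (Unique)
import Data.List.Relation.Unary.Unique.Propositional.Properties as Unique
open import Data.List.Relation.Binary.Disjoint.Propositional using (Disjoint)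
open import Data.List.Membership.Propositional using (_∈_; _∉_)
open import Data.List.Membership.Propositional.Properties using (∈-++⁺ˡ; ∈-++⁺ʳ; ∈-++⁻; ++-∈⇔; ∈-filter⁺; ∈-filter⁻; ∈-∃++)
open import Data.List.Membership.DecPropositional _≟_ using (_∈?_)
open import Data.Maybe using (just; nothing)
open import Data.Product using (Σ; _×_; _,_; proj₁; proj₂)
import Data.Product as Product
open import Data.Sum using (_⊎_; inj₁; inj₂; [_,_]′)
import Data.Sum as Sum
open import Data.Unit using (tt)
open import Data.Empty using (⊥; ⊥-elim)
open import Function using (_∘_; id)
open import Function.Bundles using (_⇔_; mk⇔; Equivalence)
open import Level using (0ℓ)
open import Relation.Binary.Bundles using (Setoid)
import Relation.Binary.Reasoning.Setoid
open import Relation.Binary.PropositionalEquality using (_≡_; refl; sym; trans; cong; cong₂; subst; module ≡-Reasoning)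
open import Relation.Nullary using (¬?; does; yes; no)
open import Relation.Nullary.Decidable using (dec-false; dec-true; does-⇔; _⊎-dec_)

open Equivalence using (to; from)

private variable
  x   : ℕ
  p q : ℕ → Bool

-- Leaf removal by a predicate

_∈ᵇ_ : ℕ → List ℕ → Bool
x ∈ᵇ L = does (x ∈? L)

-- The tree with subtrees l and r; an empty side is suppressed, which is
-- how a vertex of degree two disappears after removing leaves.
join : MTree → MTree → MTree
join nothing  r        = r
join (just l) nothing  = just l
join (just l) (just r) = just (node l r)

prune : (ℕ → Bool) → Tree → MTree
prune f (leaf y)   = if f y then nothing else just (leaf y)
prune f (node l r) = join (prune f l) (prune f r)

pruneᴹ : (ℕ → Bool) → MTree → MTree
pruneᴹ f nothing  = nothing
pruneᴹ f (just t) = prune f t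

─-as-prune : ∀ t L → just t ─ L ≡ prune (_∈ᵇ L) t
─-as-prune (leaf y)   L = refl
─-as-prune (node l r) L rewrite ─-as-prune l L | ─-as-prune r L
  with prune (_∈ᵇ L) l | prune (_∈ᵇ L) r
... | nothing | _       = refl
... | just _  | nothing = refl
... | just _  | just _  = refl

─-as-pruneᴹ : ∀ t L → t ─ L ≡ pruneᴹ (_∈ᵇ L) t
─-as-pruneᴹ nothing  L = refl
─-as-pruneᴹ (just t) L = ─-as-prune t L

∈-join⁻ : ∀ l r → x ∈ mlabels (join l r) → x ∈ mlabels l ⊎ x ∈ mlabels r
∈-join⁻ nothing  r        i = inj₂ i
∈-join⁻ (just l) nothing  i = inj₁ i
∈-join⁻ (just l) (just r) i = ∈-++⁻ (labels l) i

∈-joinˡ : ∀ l r → x ∈ mlabels l → x ∈ mlabels (join l r)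
∈-joinˡ (just l) nothing  i = i
∈-joinˡ (just l) (just r) i = ∈-++⁺ˡ i

∈-joinʳ : ∀ l r → x ∈ mlabels r → x ∈ mlabels (join l r)
∈-joinʳ nothing  r        i = i
∈-joinʳ (just l) (just r) i = ∈-++⁺ʳ (labels l) i

∈-prune⁻ : ∀ f t → x ∈ mlabels (prune f t) → x ∈ labels t × f x ≡ false
∈-prune⁻ f (leaf y) i with f y in fy
∈-prune⁻ f (leaf y) (here refl) | false = here refl , fy
∈-prune⁻ f (node l r) i with ∈-join⁻ (prune f l) (prune f r) i
... | inj₁ j = Product.map₁ ∈-++⁺ˡ (∈-prune⁻ f l j)
... | inj₂ j = Product.map₁ (∈-++⁺ʳ (labels l)) (∈-prune⁻ f r j)

∈-prune⁺ : ∀ f t → x ∈ labels t → f x ≡ false → x ∈ mlabels (prune f t)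
∈-prune⁺ f (leaf y) (here refl) fx rewrite fx = here refl
∈-prune⁺ f (node l r) i fx with ∈-++⁻ (labels l) i
... | inj₁ j = ∈-joinˡ (prune f l) (prune f r) (∈-prune⁺ f l j fx)
... | inj₂ j = ∈-joinʳ (prune f l) (prune f r) (∈-prune⁺ f r j fx)

unique-++⁻ : ∀ xs {ys : List ℕ} → Unique (xs ++ ys) → Unique xs × Unique ys × Disjoint xs ys
unique-++⁻ []       u       = [] , u , λ ()
unique-++⁻ (x ∷ xs) (x∉ ∷ u) with unique-++⁻ xs u
... | uxs , uys , xs#ys = ++⁻ˡ xs x∉ ∷ uxs , uys , disjoint
  where
  disjoint : Disjoint (x ∷ xs) _
  disjoint (here refl , j) = All.lookup x∉ (∈-++⁺ʳ xs j) refl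
  disjoint (there i   , j) = xs#ys (i , j)

unique-join : ∀ l r → Unique (mlabels l) → Unique (mlabels r)
  → Disjoint (mlabels l) (mlabels r) → Unique (mlabels (join l r))
unique-join nothing  r        _  ur _     = ur
unique-join (just l) nothing  ul _  _     = ul
unique-join (just l) (just r) ul ur l#r   = Unique.++⁺ ul ur l#r

unique-prune : ∀ f t → Unique (labels t) → Unique (mlabels (prune f t))
unique-prune f (leaf y) u with f y
... | true  = []
... | false = u
unique-prune f (node l r) u with unique-++⁻ (labels l) u
... | ul , ur , l#r = unique-join (prune f l) (prune f r) (unique-prune f l ul) (unique-prune f r ur)
  λ (i , j) → l#r (proj₁ (∈-prune⁻ f l i) , proj₁ (∈-prune⁻ f r j))

≅-refl : ∀ t → t ≅ t
≅-refl (leaf y)   = refl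
≅-refl (node l r) = inj₁ (≅-refl l , ≅-refl r)

≅-sym : ∀ s t → s ≅ t → t ≅ s
≅-sym (leaf x)   (leaf y)     e                = sym e
≅-sym (node l r) (node l′ r′) (inj₁ (el , er)) = inj₁ (≅-sym l l′ el , ≅-sym r r′ er)
≅-sym (node l r) (node l′ r′) (inj₂ (el , er)) = inj₂ (≅-sym r l′ er , ≅-sym l r′ el)

≅-trans : ∀ s t u → s ≅ t → t ≅ u → s ≅ u
≅-trans (leaf x) (leaf y) (leaf z) e e′ = trans e e′
≅-trans (node l r) (node l′ r′) (node l″ r″) (inj₁ (a , b)) (inj₁ (c , d)) =
  inj₁ (≅-trans l l′ l″ a c , ≅-trans r r′ r″ b d)
≅-trans (node l r) (node l′ r′) (node l″ r″) (inj₁ (a , b)) (inj₂ (c , d)) =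
  inj₂ (≅-trans l l′ r″ a c , ≅-trans r r′ l″ b d)
≅-trans (node l r) (node l′ r′) (node l″ r″) (inj₂ (a , b)) (inj₁ (c , d)) =
  inj₂ (≅-trans l r′ r″ a d , ≅-trans r l′ l″ b c)
≅-trans (node l r) (node l′ r′) (node l″ r″) (inj₂ (a , b)) (inj₂ (c , d)) =
  inj₁ (≅-trans l r′ l″ a d , ≅-trans r l′ r″ b c)

∈-resp-≅ : ∀ s t → s ≅ t → x ∈ labels s → x ∈ labels t
∈-resp-≅ (leaf x) (leaf y) refl i = i
∈-resp-≅ (node l r) (node l′ r′) (inj₁ (el , er)) i with ∈-++⁻ (labels l) i
... | inj₁ j = ∈-++⁺ˡ (∈-resp-≅ l l′ el j)
... | inj₂ j = ∈-++⁺ʳ (labels l′) (∈-resp-≅ r r′ er j)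
∈-resp-≅ (node l r) (node l′ r′) (inj₂ (el , er)) i with ∈-++⁻ (labels l) i
... | inj₁ j = ∈-++⁺ʳ (labels l′) (∈-resp-≅ l r′ el j)
... | inj₂ j = ∈-++⁺ˡ (∈-resp-≅ r l′ er j)

≅ᴹ-refl : ∀ a → a ≅ᴹ a
≅ᴹ-refl nothing  = tt
≅ᴹ-refl (just t) = ≅-refl t

≅ᴹ-sym : ∀ a b → a ≅ᴹ b → b ≅ᴹ a
≅ᴹ-sym nothing  nothing  _ = tt
≅ᴹ-sym (just s) (just t) e = ≅-sym s t e

≅ᴹ-trans : ∀ a b c → a ≅ᴹ b → b ≅ᴹ c → a ≅ᴹ c
≅ᴹ-trans nothing  nothing  nothing  _ _  = tt
≅ᴹ-trans (just s) (just t) (just u) e e′ = ≅-trans s t u e e′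

∈-resp-≅ᴹ : ∀ a b → a ≅ᴹ b → x ∈ mlabels a → x ∈ mlabels b
∈-resp-≅ᴹ (just s) (just t) e i = ∈-resp-≅ s t e i

≅ᴹ-nothing : ∀ a → nothing ≅ᴹ a → a ≡ nothing
≅ᴹ-nothing nothing _ = refl

≡⇒≅ᴹ : ∀ {a b} → a ≡ b → a ≅ᴹ b
≡⇒≅ᴹ {a} refl = ≅ᴹ-refl a

≅ᴹ-subst : ∀ {a a′ b b′} → a ≡ a′ → b ≡ b′ → a′ ≅ᴹ b′ → a ≅ᴹ b
≅ᴹ-subst refl refl a≅b = a≅b

≅ᴹ-setoid : Setoid 0ℓ 0ℓ
≅ᴹ-setoid = record
  { Carrier       = MTree
  ; _≈_           = _≅ᴹ_
  ; isEquivalence = record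
    { refl  = λ {a} → ≅ᴹ-refl a
    ; sym   = λ {a} {b} → ≅ᴹ-sym a b
    ; trans = λ {a} {b} {c} → ≅ᴹ-trans a b c
    }
  }

module ≅-Reasoning = Relation.Binary.Reasoning.Setoid ≅ᴹ-setoid

node-comm : ∀ l r → node l r ≅ node r l
node-comm l r = inj₂ (≅-refl l , ≅-refl r)

join-cong : ∀ l l′ r r′ → l ≅ᴹ l′ → r ≅ᴹ r′ → join l r ≅ᴹ join l′ r′
join-cong nothing  nothing  r        r′        _  er = er
join-cong (just l) (just l′) nothing nothing   el _  = el
join-cong (just l) (just l′) (just r) (just r′) el er = inj₁ (el , er)

join-comm : ∀ l r → join l r ≅ᴹ join r l
join-comm nothing  nothing  = tt
join-comm nothing  (just r) = ≅-refl r
join-comm (just l) nothing  = ≅-refl l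
join-comm (just l) (just r) = inj₂ (≅-refl l , ≅-refl r)

prune-cong : ∀ f s t → s ≅ t → prune f s ≅ᴹ prune f t
prune-cong f (leaf x) (leaf y) refl = ≅ᴹ-refl (prune f (leaf x))
prune-cong f (node l r) (node l′ r′) (inj₁ (el , er)) =
  join-cong (prune f l) (prune f l′) (prune f r) (prune f r′) (prune-cong f l l′ el) (prune-cong f r r′ er)
prune-cong f (node l r) (node l′ r′) (inj₂ (el , er)) = begin
  join (prune f l) (prune f r)    ≈⟨ join-cong (prune f l) (prune f r′) (prune f r) (prune f l′)
                                       (prune-cong f l r′ el) (prune-cong f r l′ er) ⟩
  join (prune f r′) (prune f l′)  ≈⟨ join-comm (prune f r′) (prune f l′) ⟩
  join (prune f l′) (prune f r′)  ∎
  where open ≅-Reasoning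

pruneᴹ-cong : ∀ f a b → a ≅ᴹ b → pruneᴹ f a ≅ᴹ pruneᴹ f b
pruneᴹ-cong f nothing  nothing  _ = tt
pruneᴹ-cong f (just s) (just t) e = prune-cong f s t e

prune-ext : ∀ f g t → (∀ x → x ∈ labels t → f x ≡ g x) → prune f t ≡ prune g t
prune-ext f g (leaf y) f≗g rewrite f≗g y (here refl) = refl
prune-ext f g (node l r) f≗g =
  cong₂ join (prune-ext f g l (λ x → f≗g x ∘ ∈-++⁺ˡ)) (prune-ext f g r (λ x → f≗g x ∘ ∈-++⁺ʳ (labels l)))

pruneᴹ-ext : ∀ f g t → (∀ x → x ∈ mlabels t → f x ≡ g x) → pruneᴹ f t ≡ pruneᴹ g t
pruneᴹ-ext f g nothing  _   = refl
pruneᴹ-ext f g (just t) f≗g = prune-ext f g t f≗g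

prune-all : ∀ f t → (∀ x → x ∈ labels t → f x ≡ true) → prune f t ≡ nothing
prune-all f (leaf y) all rewrite all y (here refl) = refl
prune-all f (node l r) all
  rewrite prune-all f l (λ x → all x ∘ ∈-++⁺ˡ) | prune-all f r (λ x → all x ∘ ∈-++⁺ʳ (labels l)) = refl

prune-none : ∀ f t → (∀ x → x ∈ labels t → f x ≡ false) → prune f t ≡ just t
prune-none f (leaf y) none rewrite none y (here refl) = refl
prune-none f (node l r) none
  rewrite prune-none f l (λ x → none x ∘ ∈-++⁺ˡ) | prune-none f r (λ x → none x ∘ ∈-++⁺ʳ (labels l)) = refl

pruneᴹ-join : ∀ g l r → pruneᴹ g (join l r) ≡ join (pruneᴹ g l) (pruneᴹ g r)
pruneᴹ-join g nothing  r        = refl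
pruneᴹ-join g (just l) nothing  with prune g l
... | nothing = refl
... | just _  = refl
pruneᴹ-join g (just l) (just r) = refl

prune-prune : ∀ f g t → pruneᴹ g (prune f t) ≡ prune (λ x → f x ∨ g x) t
prune-prune f g (leaf y) with f y
... | true  = refl
... | false = refl
prune-prune f g (node l r) =
  trans (pruneᴹ-join g (prune f l) (prune f r)) (cong₂ join (prune-prune f g l) (prune-prune f g r))

pruneᴹ-prune : ∀ f g t → pruneᴹ g (pruneᴹ f t) ≡ pruneᴹ (λ x → f x ∨ g x) t
pruneᴹ-prune f g nothing  = refl
pruneᴹ-prune f g (just t) = prune-prune f g t

∉⇔∈ᵇ-false : ∀ L → x ∉ L ⇔ (x ∈ᵇ L ≡ false)
∉⇔∈ᵇ-false {x} L with x ∈? L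
... | yes x∈L = mk⇔ (λ x∉L → ⊥-elim (x∉L x∈L)) (λ ())
... | no  x∉L = mk⇔ (λ _ → refl) (λ _ → x∉L)

∈-─ : ∀ t X → x ∈ mlabels (t ─ X) ⇔ (x ∈ mlabels t × x ∉ X)
∈-─ nothing  X = mk⇔ (λ ()) λ { (() , _) }
∈-─ (just t) X rewrite ─-as-prune t X = mk⇔
  (λ i → Product.map₂ (from (∉⇔∈ᵇ-false X)) (∈-prune⁻ _ t i))
  (λ (i , x∉X) → ∈-prune⁺ _ t i (to (∉⇔∈ᵇ-false X) x∉X))

phylo-─ : ∀ t X → Phylo t → Phylo (t ─ X)
phylo-─ nothing  X u = u
phylo-─ (just t) X u rewrite ─-as-prune t X = unique-prune _ t u

─-cong : ∀ s t X → s ≅ᴹ t → (s ─ X) ≅ᴹ (t ─ X)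
─-cong s t X s≅t rewrite ─-as-pruneᴹ s X | ─-as-pruneᴹ t X = pruneᴹ-cong _ s t s≅t

─-ext : ∀ t X Y → (∀ x → x ∈ mlabels t → (x ∈ X ⇔ x ∈ Y)) → t ─ X ≡ t ─ Y
─-ext t X Y same rewrite ─-as-pruneᴹ t X | ─-as-pruneᴹ t Y =
  pruneᴹ-ext _ _ t (λ x i → does-⇔ (same x i) (x ∈? X) (x ∈? Y))

─-all : ∀ t X → (∀ x → x ∈ mlabels t → x ∈ X) → t ─ X ≡ nothing
─-all nothing  X _   = refl
─-all (just t) X all = trans (─-as-prune t X) (prune-all _ t (λ x i → dec-true (x ∈? X) (all x i)))

─-none : ∀ t X → (∀ x → x ∈ mlabels t → x ∉ X) → t ─ X ≡ t
─-none nothing  X _    = refl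
─-none (just t) X none = trans (─-as-prune t X) (prune-none _ t (λ x i → dec-false (x ∈? X) (none x i)))

─-twice : ∀ t X Y → (t ─ X) ─ Y ≡ pruneᴹ (λ x → x ∈ᵇ X ∨ x ∈ᵇ Y) t
─-twice t X Y = begin
  (t ─ X) ─ Y                         ≡⟨ ─-as-pruneᴹ (t ─ X) Y ⟩
  pruneᴹ (_∈ᵇ Y) (t ─ X)              ≡⟨ cong (pruneᴹ (_∈ᵇ Y)) (─-as-pruneᴹ t X) ⟩
  pruneᴹ (_∈ᵇ Y) (pruneᴹ (_∈ᵇ X) t)   ≡⟨ pruneᴹ-prune (_∈ᵇ X) (_∈ᵇ Y) t ⟩
  pruneᴹ (λ x → x ∈ᵇ X ∨ x ∈ᵇ Y) t    ∎
  where open ≡-Reasoning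

─-comm : ∀ t X Y → (t ─ X) ─ Y ≡ (t ─ Y) ─ X
─-comm t X Y = begin
  (t ─ X) ─ Y                         ≡⟨ ─-twice t X Y ⟩
  pruneᴹ (λ x → x ∈ᵇ X ∨ x ∈ᵇ Y) t    ≡⟨ pruneᴹ-ext _ _ t (λ x _ → ∨-comm (x ∈ᵇ X) (x ∈ᵇ Y)) ⟩
  pruneᴹ (λ x → x ∈ᵇ Y ∨ x ∈ᵇ X) t    ≡⟨ ─-twice t Y X ⟨
  (t ─ Y) ─ X                         ∎
  where open ≡-Reasoning

─-union : ∀ t X Y Z → (∀ x → x ∈ Z ⇔ (x ∈ X ⊎ x ∈ Y)) → (t ─ X) ─ Y ≡ t ─ Z
─-union t X Y Z cover = begin
  (t ─ X) ─ Y                         ≡⟨ ─-twice t X Y ⟩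
  pruneᴹ (λ x → x ∈ᵇ X ∨ x ∈ᵇ Y) t    ≡⟨ pruneᴹ-ext _ _ t (λ x _ → does-⇔ (cover x) (x ∈? Z) ((x ∈? X) ⊎-dec (x ∈? Y))) ⟨
  pruneᴹ (_∈ᵇ Z) t                    ≡⟨ ─-as-pruneᴹ t Z ⟨
  t ─ Z                               ∎
  where open ≡-Reasoning

restrict-as-─ : ∀ t L X → (∀ x → x ∈ mlabels t → (x ∉ X ⇔ x ∈ L)) → t ∣ L ≡ t ─ X
restrict-as-─ t L X complement = ─-ext t Lᶜ X same
  where
  Lᶜ : List ℕ
  Lᶜ = filter (λ x → ¬? (x ∈? L)) (mlabels t)
  same : ∀ x → x ∈ mlabels t → (x ∈ Lᶜ ⇔ x ∈ X)
  same x i = mk⇔ outside inside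
    where
    outside : x ∈ Lᶜ → x ∈ X
    outside j with x ∈? X
    ... | yes x∈X = x∈X
    ... | no  x∉X = ⊥-elim (proj₂ (∈-filter⁻ (λ x → ¬? (x ∈? L)) {xs = mlabels t} j) (to (complement x i) x∉X))
    inside : x ∈ X → x ∈ Lᶜ
    inside x∈X = ∈-filter⁺ (λ x → ¬? (x ∈? L)) i (λ x∈L → from (complement x i) x∈L x∈X)

-- Amalgamation of two agreeing trees

Avoids : (ℕ → Bool) → Tree → Set
Avoids f t = ∀ x → x ∈ labels t → f x ≡ false

Clean : (ℕ → Bool) → Tree → Set
Clean f t = Unique (labels t) × Avoids f t

clean-children : ∀ l r → Clean p (node l r) → Clean p l × Clean p r × Disjoint (labels l) (labels r)
clean-children l r (u , avoids) with unique-++⁻ (labels l) u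
... | ul , ur , l#r = (ul , λ x → avoids x ∘ ∈-++⁺ˡ) , (ur , λ x → avoids x ∘ ∈-++⁺ʳ (labels l)) , l#r

pruned-away : ∀ f t → prune f t ≡ nothing → x ∈ labels t → f x ≡ false → ⊥
pruned-away f t gone i fx with () ← subst (λ m → _ ∈ mlabels m) gone (∈-prune⁺ f t i fx)

record Amalgam (p q : ℕ → Bool) (A B : Tree) : Set where
  field
    tree     : Tree
    unique   : Unique (labels tree)
    covered  : ∀ x → x ∈ labels tree → x ∈ labels A ⊎ x ∈ labels B
    pruned-p : prune p tree ≅ᴹ just A
    pruned-q : prune q tree ≅ᴹ just B
open Amalgam

amalgam-swap : ∀ {A B} → Amalgam p q A B → Amalgam q p B A
amalgam-swap am = record
  { tree = tree am ; unique = unique am ; covered = λ x → Sum.swap ∘ covered am x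
  ; pruned-p = pruned-q am ; pruned-q = pruned-p am }

amalgam-resp : ∀ A A′ {B} → A ≅ A′ → Amalgam p q A B → Amalgam p q A′ B
amalgam-resp {p = p} A A′ A≅A′ am = record
  { tree     = tree am
  ; unique   = unique am
  ; covered  = λ x → Sum.map₁ (∈-resp-≅ A A′ A≅A′) ∘ covered am x
  ; pruned-p = ≅ᴹ-trans (prune p (tree am)) (just A) (just A′) (pruned-p am) A≅A′
  ; pruned-q = pruned-q am
  }

∈-amalgamᴬ : ∀ {A B} (am : Amalgam p q A B) → x ∈ labels A → x ∈ labels (tree am) × p x ≡ false
∈-amalgamᴬ {p = p} {A = A} am i =
  ∈-prune⁻ p (tree am) (∈-resp-≅ᴹ (just A) (prune p (tree am)) (≅ᴹ-sym (prune p (tree am)) (just A) (pruned-p am)) i)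

amalgam-∈ᴬ : ∀ {A B} (am : Amalgam p q A B) → x ∈ labels (tree am) → p x ≡ false → x ∈ labels A
amalgam-∈ᴬ {p = p} {A = A} am i px = ∈-resp-≅ᴹ (prune p (tree am)) (just A) (pruned-p am) (∈-prune⁺ p (tree am) i px)

amalgam-∈ᴮ : ∀ {A B} (am : Amalgam p q A B) → x ∈ labels (tree am) → p x ≡ true → x ∈ labels B
amalgam-∈ᴮ am i px with covered am _ i
... | inj₂ j = j
... | inj₁ j with () ← trans (sym px) (proj₂ (∈-amalgamᴬ am j))

amalgam-beside : ∀ A B → Clean p A → Clean q B → prune q A ≡ nothing → prune p B ≡ nothing → Amalgam p q A B
amalgam-beside {p = p} {q = q} A B (uA , avoidsA) (uB , avoidsB) qA pB = record
  { tree     = node A B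
  ; unique   = Unique.++⁺ uA uB (λ (i , j) → pruned-away q A qA i (avoidsB _ j))
  ; covered  = λ x → ∈-++⁻ (labels A)
  ; pruned-p = join-cong (prune p A) (just A) (prune p B) nothing (≡⇒≅ᴹ (prune-none p A avoidsA)) (≡⇒≅ᴹ pB)
  ; pruned-q = join-cong (prune q A) nothing (prune q B) (just B) (≡⇒≅ᴹ qA) (≡⇒≅ᴹ (prune-none q B avoidsB))
  }

amalgam-within : ∀ A B → Clean q B → just A ≅ᴹ prune p B → Amalgam p q A B
amalgam-within {q = q} {p = p} A B (uB , avoidsB) A≅pB = record
  { tree     = B
  ; unique   = uB
  ; covered  = λ _ → inj₂
  ; pruned-p = ≅ᴹ-sym (just A) (prune p B) A≅pB
  ; pruned-q = ≡⇒≅ᴹ (prune-none q B avoidsB)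
  }

amalgam-graft : ∀ A₁ A₂ {B} → Clean p A₁ → prune q A₁ ≡ nothing
  → Disjoint (labels A₁) (labels A₂) → Amalgam p q A₂ B → Amalgam p q (node A₁ A₂) B
amalgam-graft {p = p} {q = q} A₁ A₂ {B} (uA₁ , avoidsA₁) qA₁ A₁#A₂ am = record
  { tree     = node A₁ (tree am)
  ; unique   = Unique.++⁺ uA₁ (unique am) (λ (i , j) → A₁#A₂ (i , amalgam-∈ᴬ am j (avoidsA₁ _ i)))
  ; covered  = λ x k → [ inj₁ ∘ ∈-++⁺ˡ , Sum.map₁ (∈-++⁺ʳ (labels A₁)) ∘ covered am x ]′ (∈-++⁻ (labels A₁) k)
  ; pruned-p = join-cong (prune p A₁) (just A₁) (prune p (tree am)) (just A₂)
                 (≡⇒≅ᴹ (prune-none p A₁ avoidsA₁)) (pruned-p am)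
  ; pruned-q = join-cong (prune q A₁) nothing (prune q (tree am)) (just B) (≡⇒≅ᴹ qA₁) (pruned-q am)
  }

amalgam-graftʳ : ∀ A₁ A₂ {B} → Clean p A₂ → prune q A₂ ≡ nothing
  → Disjoint (labels A₁) (labels A₂) → Amalgam p q A₁ B → Amalgam p q (node A₁ A₂) B
amalgam-graftʳ A₁ A₂ cA₂ qA₂ A₁#A₂ am =
  amalgam-resp (node A₂ A₁) (node A₁ A₂) (node-comm A₂ A₁) (amalgam-graft A₂ A₁ cA₂ qA₂ (A₁#A₂ ∘ Product.swap) am)

amalgam-node : ∀ {A₁ A₂ B₁ B₂} → Disjoint (labels A₁) (labels A₂) → Disjoint (labels B₁) (labels B₂)
  → Amalgam p q A₁ B₁ → Amalgam p q A₂ B₂ → Amalgam p q (node A₁ A₂) (node B₁ B₂)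
amalgam-node {p = p} {q = q} {A₁} {A₂} {B₁} {B₂} A₁#A₂ B₁#B₂ am₁ am₂ = record
  { tree     = node (tree am₁) (tree am₂)
  ; unique   = Unique.++⁺ (unique am₁) (unique am₂) (λ (i , j) → separate i j)
  ; covered  = λ x k → [ Sum.map ∈-++⁺ˡ ∈-++⁺ˡ ∘ covered am₁ x
                       , Sum.map (∈-++⁺ʳ (labels A₁)) (∈-++⁺ʳ (labels B₁)) ∘ covered am₂ x
                       ]′ (∈-++⁻ (labels (tree am₁)) k)
  ; pruned-p = join-cong (prune p (tree am₁)) (just A₁) (prune p (tree am₂)) (just A₂) (pruned-p am₁) (pruned-p am₂)
  ; pruned-q = join-cong (prune q (tree am₁)) (just B₁) (prune q (tree am₂)) (just B₂) (pruned-q am₁) (pruned-q am₂)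
  }
  where
  -- A shared label would lie in both A₁ and A₂ (if p rejects it) or in both
  -- B₁ and B₂ (if p accepts it).
  separate : x ∈ labels (tree am₁) → x ∈ labels (tree am₂) → ⊥
  separate {x} i j with p x in px
  ... | false = A₁#A₂ (amalgam-∈ᴬ am₁ i px , amalgam-∈ᴬ am₂ j px)
  ... | true  = B₁#B₂ (amalgam-∈ᴮ am₁ i px , amalgam-∈ᴮ am₂ j px)

-- Two trees that agree on their common labels have an amalgam.  A leaf is
-- either invisible to q or already contained in B.  A subtree of A that is
-- invisible to q is grafted on; once both subtrees of A are visible, the
-- same is done with B, and finally the two root splits are matched.
mutual
  amalgamate : ∀ A B → Clean p A → Clean q B → prune q A ≅ᴹ prune p B → Amalgam p q A B
  amalgamate {p = p} {q = q} (leaf y) B cA cB agree with q y in qy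
  ... | true  = amalgam-beside (leaf y) B cA cB
                  (prune-all q (leaf y) λ { _ (here refl) → qy }) (≅ᴹ-nothing (prune p B) agree)
  ... | false = amalgam-within (leaf y) B cB agree
  amalgamate {p = p} {q = q} (node A₁ A₂) B cA cB agree
    with clean-children A₁ A₂ cA | prune q A₁ in qA₁
  ... | cA₁ , cA₂ , A₁#A₂ | nothing =
    amalgam-graft A₁ A₂ cA₁ qA₁ A₁#A₂ (amalgamate A₂ B cA₂ cB agree)
  ... | cA₁ , cA₂ , A₁#A₂ | just _ with prune q A₂ in qA₂
  ...   | nothing = amalgam-graftʳ A₁ A₂ cA₂ qA₂ A₁#A₂ (amalgamate A₁ B cA₁ cB (≅ᴹ-subst qA₁ refl agree))
  ...   | just _  = amalgamate-visible A₁ A₂ B qA₁ qA₂ cA cB agree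

  -- Both subtrees of A survive pruning q, hence so do both subtrees of B
  -- under pruning p (and B cannot be a leaf).
  amalgamate-visible : ∀ A₁ A₂ B {a₁ a₂} → prune q A₁ ≡ just a₁ → prune q A₂ ≡ just a₂
    → Clean p (node A₁ A₂) → Clean q B → just (node a₁ a₂) ≅ᴹ prune p B → Amalgam p q (node A₁ A₂) B
  amalgamate-visible {p = p} A₁ A₂ (leaf y) _ _ _ _ agree with p y
  ... | true  = ⊥-elim agree
  ... | false = ⊥-elim agree
  amalgamate-visible {q = q} {p = p} A₁ A₂ (node B₁ B₂) qA₁ qA₂ cA cB agree
    with clean-children A₁ A₂ cA | clean-children B₁ B₂ cB | prune p B₁ in pB₁
  ... | _ | cB₁ , cB₂ , B₁#B₂ | nothing =
    amalgam-swap (amalgam-graft B₁ B₂ cB₁ pB₁ B₁#B₂ (amalgam-swap (amalgamate-visible A₁ A₂ B₂ qA₁ qA₂ cA cB₂ agree)))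
  ... | _ | cB₁ , cB₂ , B₁#B₂ | just b₁ with prune p B₂ in pB₂
  ...   | nothing = amalgam-swap (amalgam-graftʳ B₁ B₂ cB₂ pB₂ B₁#B₂
                      (amalgam-swap (amalgamate-visible A₁ A₂ B₁ qA₁ qA₂ cA cB₁ (≅ᴹ-subst refl pB₁ agree))))
  amalgamate-visible {q = q} {p = p} A₁ A₂ (node B₁ B₂) {a₁} {a₂} qA₁ qA₂ cA cB agree
    | cA₁ , cA₂ , A₁#A₂ | cB₁ , cB₂ , B₁#B₂ | just b₁ | just b₂ = matched agree
    where
    matched : node a₁ a₂ ≅ node b₁ b₂ → Amalgam p q (node A₁ A₂) (node B₁ B₂)
    matched (inj₁ (a₁≅b₁ , a₂≅b₂)) = amalgam-node A₁#A₂ B₁#B₂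
      (amalgamate A₁ B₁ cA₁ cB₁ (≅ᴹ-subst qA₁ pB₁ a₁≅b₁))
      (amalgamate A₂ B₂ cA₂ cB₂ (≅ᴹ-subst qA₂ pB₂ a₂≅b₂))
    matched (inj₂ (a₁≅b₂ , a₂≅b₁)) =
      amalgam-swap (amalgam-resp (node B₂ B₁) (node B₁ B₂) (node-comm B₂ B₁) (amalgam-swap
        (amalgam-node A₁#A₂ (B₁#B₂ ∘ Product.swap)
          (amalgamate A₁ B₂ cA₁ cB₂ (≅ᴹ-subst qA₁ pB₂ a₁≅b₂))
          (amalgamate A₂ B₁ cA₂ cB₁ (≅ᴹ-subst qA₂ pB₁ a₂≅b₁)))))

compatible-sym : ∀ A B → Compatible A B → Compatible B A
compatible-sym A B (T , u , labelsT , restrictA , restrictB) =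
  T , u , (λ x → mk⇔ (Sum.swap ∘ to (labelsT x)) (from (labelsT x) ∘ Sum.swap)) , restrictB , restrictA

compatible-empty : ∀ B → Phylo B → Compatible nothing B
compatible-empty B u = B , u , (λ x → mk⇔ inj₂ [ (λ ()) , id ]′) , ≡⇒≅ᴹ restrict-none , ≡⇒≅ᴹ restrict-all
  where
  restrict-none : B ∣ [] ≡ nothing
  restrict-none = trans (restrict-as-─ B [] (mlabels B) (λ x i → mk⇔ (λ x∉B → ⊥-elim (x∉B i)) (λ ())))
                        (─-all B (mlabels B) (λ _ → id))
  restrict-all : B ∣ mlabels B ≡ B
  restrict-all = trans (restrict-as-─ B (mlabels B) [] (λ x i → mk⇔ (λ _ → i) (λ _ ()))) (─-none B [] (λ _ _ ()))

amalgam-restrict : ∀ {A B} X (am : Amalgam (_∈ᵇ X) q A B) → (just (tree am) ∣ labels A) ≅ᴹ just A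
amalgam-restrict {A = A} X am = begin
  just (tree am) ∣ labels A  ≡⟨ restrict-as-─ (just (tree am)) (labels A) X complement ⟩
  just (tree am) ─ X         ≡⟨ ─-as-prune (tree am) X ⟩
  prune (_∈ᵇ X) (tree am)    ≈⟨ pruned-p am ⟩
  just A                     ∎
  where
  open ≅-Reasoning
  complement : ∀ x → x ∈ labels (tree am) → (x ∉ X ⇔ x ∈ labels A)
  complement x i = mk⇔ (amalgam-∈ᴬ am i ∘ to (∉⇔∈ᵇ-false X)) (from (∉⇔∈ᵇ-false X) ∘ proj₂ ∘ ∈-amalgamᴬ am)

amalgam⇒compatible : ∀ {A B} X Y → Amalgam (_∈ᵇ X) (_∈ᵇ Y) A B → Compatible (just A) (just B)
amalgam⇒compatible X Y am =
  just (tree am) , unique am , (λ x → mk⇔ (covered am x) contains) , amalgam-restrict X am , amalgam-restrict Y (amalgam-swap am)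
  where
  contains : x ∈ _ ⊎ x ∈ _ → x ∈ labels (tree am)
  contains (inj₁ i) = proj₁ (∈-amalgamᴬ am i)
  contains (inj₂ j) = proj₁ (∈-amalgamᴬ (amalgam-swap am) j)

agree⇒compatible : ∀ A B X Y → Phylo A → Phylo B → (∀ x → x ∈ mlabels A → x ∉ X)
  → (∀ x → x ∈ mlabels B → x ∉ Y) → (A ─ Y) ≅ᴹ (B ─ X) → Compatible A B
agree⇒compatible nothing  B        X Y _  uB _ _ _ = compatible-empty B uB
agree⇒compatible (just a) nothing  X Y uA _  _ _ _ = compatible-sym nothing (just a) (compatible-empty (just a) uA)
agree⇒compatible (just a) (just b) X Y uA uB avoidsX avoidsY agree =
  amalgam⇒compatible X Y (amalgamate a b
    (uA , λ x → to (∉⇔∈ᵇ-false X) ∘ avoidsX x) (uB , λ x → to (∉⇔∈ᵇ-false Y) ∘ avoidsY x)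
    (≅ᴹ-subst (sym (─-as-prune a Y)) (sym (─-as-prune b X)) agree))

compatible⇒agree : ∀ A B X Y → Compatible A B
  → (∀ x → x ∈ mlabels A ⊎ x ∈ mlabels B → (x ∉ X ⇔ x ∈ mlabels A))
  → (∀ x → x ∈ mlabels A ⊎ x ∈ mlabels B → (x ∉ Y ⇔ x ∈ mlabels B))
  → (A ─ Y) ≅ᴹ (B ─ X)
compatible⇒agree A B X Y (T , _ , labelsT , restrictA , restrictB) keptA keptB = begin
  A ─ Y                ≈⟨ ─-cong (T ∣ mlabels A) A Y restrictA ⟨
  (T ∣ mlabels A) ─ Y  ≡⟨ cong (_─ Y) (restrict-as-─ T (mlabels A) X (λ x → keptA x ∘ to (labelsT x))) ⟩
  (T ─ X) ─ Y          ≡⟨ ─-comm T X Y ⟩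
  (T ─ Y) ─ X          ≡⟨ cong (_─ X) (restrict-as-─ T (mlabels B) Y (λ x → keptB x ∘ to (labelsT x))) ⟨
  (T ∣ mlabels B) ─ X  ≈⟨ ─-cong (T ∣ mlabels B) B X restrictB ⟩
  B ─ X                ∎
  where open ≅-Reasoning

_∪_ : List ℕ → List ℕ → List ℕ
X ∪ Y = X ++ filter (λ y → ¬? (y ∈? X)) Y

∈-∪ : ∀ X Y → x ∈ X ∪ Y ⇔ (x ∈ X ⊎ x ∈ Y)
∈-∪ {x} X Y = mk⇔ split merge
  where
  split : x ∈ X ∪ Y → x ∈ X ⊎ x ∈ Y
  split k = Sum.map₂ (proj₁ ∘ ∈-filter⁻ (λ y → ¬? (y ∈? X)) {xs = Y}) (∈-++⁻ X k)
  merge : x ∈ X ⊎ x ∈ Y → x ∈ X ∪ Y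
  merge (inj₁ i) = ∈-++⁺ˡ i
  merge (inj₂ j) with x ∈? X
  ... | yes i   = ∈-++⁺ˡ i
  ... | no  x∉X = ∈-++⁺ʳ X (∈-filter⁺ (λ y → ¬? (y ∈? X)) j x∉X)

unique-∪ : ∀ X Y → Unique X → Unique Y → Unique (X ∪ Y)
unique-∪ X Y uX uY = Unique.++⁺ uX (Unique.filter⁺ (λ y → ¬? (y ∈? X)) uY)
  (λ (i , j) → proj₂ (∈-filter⁻ (λ y → ¬? (y ∈? X)) {xs = Y} j) i)

length-∪ : ∀ X Y → length (X ∪ Y) ≤ length X + length Y
length-∪ X Y = ≤-trans (≤-reflexive (length-++ X)) (+-monoʳ-≤ (length X) (length-filter (λ y → ¬? (y ∈? X)) Y))

length-∪-< : ∀ X Y → x ∈ X → x ∈ Y → length (X ∪ Y) < length X + length Y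
length-∪-< X Y i j = begin-strict
  length (X ∪ Y)                                      ≡⟨ length-++ X ⟩
  length X + length (filter (λ y → ¬? (y ∈? X)) Y)    <⟨ +-monoʳ-< (length X) dropped ⟩
  length X + length Y                                 ∎
  where
  open ≤-Reasoning
  dropped : length (filter (λ y → ¬? (y ∈? X)) Y) < length Y
  dropped = filter-notAll (λ y → ¬? (y ∈? X)) Y (Any.map (λ { refl y∉X → y∉X i }) j)

unique-⊆-length : ∀ {xs ys : List ℕ} → Unique xs → (∀ x → x ∈ xs → x ∈ ys) → length xs ≤ length ys
unique-⊆-length {[]}     _          _   = z≤n
unique-⊆-length {x ∷ xs} (x∉xs ∷ u) sub with ∈-∃++ (sub x (here refl))
... | ys₁ , ys₂ , refl =
  ≤-trans (s≤s (unique-⊆-length u sub′)) (≤-reflexive (sym (length-++-sucʳ ys₁ x ys₂)))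
  where
  -- Every element of xs differs from x, so it survives deleting x.
  sub′ : ∀ y → y ∈ xs → y ∈ ys₁ ++ ys₂
  sub′ y j with ∈-++⁻ ys₁ (sub y (there j))
  ... | inj₁ k          = ∈-++⁺ˡ k
  ... | inj₂ (here y≡x) = ⊥-elim (All.lookup x∉xs j (sym y≡x))
  ... | inj₂ (there k)  = ∈-++⁺ʳ ys₁ k

-- Leaf-disagreements versus agreement sets

-- Splitting an agreement set X′ = X₁ ∪ X₂ (not necessarily disjointly)
-- gives a leaf-disagreement: T₁ - X₁ and T₂ - X₂ agree on their common labels.
disagreement-from-cover : ∀ T₁ T₂ X′ X₁ X₂ → Phylo T₁ → Phylo T₂ → AgreementSet T₁ T₂ X′
  → Unique X₁ → Unique X₂ → (∀ x → x ∈ X′ ⇔ (x ∈ X₁ ⊎ x ∈ X₂)) → LeafDisagreement T₁ T₂ X₁ X₂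
disagreement-from-cover T₁ T₂ X′ X₁ X₂ u₁ u₂ ((_ , X′⊆T₁) , agree) uX₁ uX₂ cover =
  (uX₁ , inside inj₁) , (uX₂ , inside inj₂) ,
  agree⇒compatible (T₁ ─ X₁) (T₂ ─ X₂) X₁ X₂ (phylo-─ T₁ X₁ u₁) (phylo-─ T₂ X₂ u₂)
    (λ x → proj₂ ∘ to (∈-─ T₁ X₁)) (λ x → proj₂ ∘ to (∈-─ T₂ X₂)) common
  where
  inside : ∀ {X} → (∀ {x} → x ∈ X → x ∈ X₁ ⊎ x ∈ X₂) → All (_∈ mlabels T₁) X
  inside part = All.tabulate (All.lookup X′⊆T₁ ∘ from (cover _) ∘ part)
  common : ((T₁ ─ X₁) ─ X₂) ≅ᴹ ((T₂ ─ X₂) ─ X₁)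
  common = begin
    (T₁ ─ X₁) ─ X₂  ≡⟨ ─-union T₁ X₁ X₂ X′ cover ⟩
    T₁ ─ X′         ≈⟨ agree ⟩
    T₂ ─ X′         ≡⟨ ─-union T₂ X₁ X₂ X′ cover ⟨
    (T₂ ─ X₁) ─ X₂  ≡⟨ ─-comm T₂ X₁ X₂ ⟩
    (T₂ ─ X₂) ─ X₁  ∎
    where open ≅-Reasoning

kept-outside : ∀ T T′ X X′ → SameLabels T′ T → x ∈ mlabels (T ─ X) ⊎ x ∈ mlabels (T′ ─ X′)
  → (x ∉ X ⇔ x ∈ mlabels (T ─ X))
kept-outside {x} T T′ X X′ same present = mk⇔ survives (proj₂ ∘ to (∈-─ T X))
  where
  survives : x ∉ X → x ∈ mlabels (T ─ X)
  survives x∉X = [ id , (λ j → from (∈-─ T X) (to (same x) (proj₁ (to (∈-─ T′ X′) j)) , x∉X)) ]′ present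

agreement-from-disagreement : ∀ T₁ T₂ X₁ X₂ → SameLabels T₁ T₂
  → LeafDisagreement T₁ T₂ X₁ X₂ → AgreementSet T₁ T₂ (X₁ ∪ X₂)
agreement-from-disagreement T₁ T₂ X₁ X₂ same ((uX₁ , X₁⊆T₁) , (uX₂ , X₂⊆T₁) , compatible) =
  (unique-∪ X₁ X₂ uX₁ uX₂ , All.tabulate ([ All.lookup X₁⊆T₁ , All.lookup X₂⊆T₁ ]′ ∘ to (∈-∪ X₁ X₂))) , common
  where
  same⁻¹ : SameLabels T₂ T₁
  same⁻¹ x = mk⇔ (from (same x)) (to (same x))
  common : (T₁ ─ (X₁ ∪ X₂)) ≅ᴹ (T₂ ─ (X₁ ∪ X₂))
  common = begin
    T₁ ─ (X₁ ∪ X₂)  ≡⟨ ─-union T₁ X₁ X₂ (X₁ ∪ X₂) (λ x → ∈-∪ X₁ X₂) ⟨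
    (T₁ ─ X₁) ─ X₂  ≈⟨ compatible⇒agree (T₁ ─ X₁) (T₂ ─ X₂) X₁ X₂ compatible
                         (λ x → kept-outside T₁ T₂ X₁ X₂ same⁻¹) (λ x → kept-outside T₂ T₁ X₂ X₁ same ∘ Sum.swap) ⟩
    (T₂ ─ X₂) ─ X₁  ≡⟨ ─-comm T₂ X₂ X₁ ⟩
    (T₂ ─ X₁) ─ X₂  ≡⟨ ─-union T₂ X₁ X₂ (X₁ ∪ X₂) (λ x → ∈-∪ X₁ X₂) ⟩
    T₂ ─ (X₁ ∪ X₂)  ∎
    where open ≅-Reasoning

PartitionsAgreementSet : MTree → MTree → ℕ → List ℕ → List ℕ → Set
PartitionsAgreementSet T₁ T₂ d X₁ X₂ =
  Σ (List ℕ) λ X′ → AgreementSet T₁ T₂ X′ × length X′ ≡ d × PartitionOf X′ X₁ X₂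

minimum-disagreement : ∀ T₁ T₂ {d} → Phylo T₁ → Phylo T₂ → IsDLR T₁ T₂ d
  → Σ (List ℕ) λ X₁ → Σ (List ℕ) λ X₂ → LeafDisagreement T₁ T₂ X₁ X₂ × ldSize X₁ X₂ ≡ d
minimum-disagreement T₁ T₂ u₁ u₂ ((X′ , agree@((uX′ , _) , _) , |X′|≡d) , _) =
  X′ , [] , disagreement-from-cover T₁ T₂ X′ X′ [] u₁ u₂ agree uX′ [] (λ x → mk⇔ inj₁ [ id , (λ ()) ]′)
  , trans (+-identityʳ (length X′)) |X′|≡d

disagreement-size : ∀ T₁ T₂ {d} → SameLabels T₁ T₂ → IsDLR T₁ T₂ d
  → ∀ X₁ X₂ → LeafDisagreement T₁ T₂ X₁ X₂ → d ≤ ldSize X₁ X₂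
disagreement-size T₁ T₂ same (_ , minimal) X₁ X₂ ld =
  ≤-trans (minimal (X₁ ∪ X₂) (agreement-from-disagreement T₁ T₂ X₁ X₂ same ld)) (length-∪ X₁ X₂)

-- An optimal leaf-disagreement partitions the agreement set X₁ ∪ X₂, whose
-- size is squeezed between d_LR and |X₁| + |X₂| ≤ d_LR.
optimal⇒partition : ∀ T₁ T₂ {d} → Phylo T₁ → Phylo T₂ → SameLabels T₁ T₂ → IsDLR T₁ T₂ d
  → ∀ X₁ X₂ → OptimalLD T₁ T₂ X₁ X₂ → PartitionsAgreementSet T₁ T₂ d X₁ X₂
optimal⇒partition T₁ T₂ {d} u₁ u₂ same dlr X₁ X₂ (ld@((uX₁ , _) , (uX₂ , _) , _) , optimal) =
  X₁ ∪ X₂ , agree , ≤-antisym (≤-trans (length-∪ X₁ X₂) at-most-d) at-least-d , uX₁ , uX₂ , disjoint , λ x → ∈-∪ X₁ X₂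
  where
  agree : AgreementSet T₁ T₂ (X₁ ∪ X₂)
  agree = agreement-from-disagreement T₁ T₂ X₁ X₂ same ld
  at-least-d : d ≤ length (X₁ ∪ X₂)
  at-least-d = proj₂ dlr (X₁ ∪ X₂) agree
  at-most-d : ldSize X₁ X₂ ≤ d
  at-most-d with Y₁ , Y₂ , ldY , |Y|≡d ← minimum-disagreement T₁ T₂ u₁ u₂ dlr =
    ≤-trans (optimal Y₁ Y₂ ldY) (≤-reflexive |Y|≡d)
  -- A shared label would make |X₁ ∪ X₂| < |X₁| + |X₂| ≤ d.
  disjoint : ∀ x → x ∈ X₁ → x ∉ X₂
  disjoint x i j = <-irrefl refl (<-≤-trans (length-∪-< X₁ X₂ i j) (≤-trans at-most-d at-least-d))

partition⇒optimal : ∀ T₁ T₂ {d} → Phylo T₁ → Phylo T₂ → SameLabels T₁ T₂ → IsDLR T₁ T₂ d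
  → ∀ X₁ X₂ → PartitionsAgreementSet T₁ T₂ d X₁ X₂ → OptimalLD T₁ T₂ X₁ X₂
partition⇒optimal T₁ T₂ {d} u₁ u₂ same dlr X₁ X₂ (X′ , agree , |X′|≡d , uX₁ , uX₂ , X₁#X₂ , cover) =
  disagreement-from-cover T₁ T₂ X′ X₁ X₂ u₁ u₂ agree uX₁ uX₂ cover , λ Y₁ Y₂ ldY → begin
    ldSize X₁ X₂       ≡⟨ length-++ X₁ ⟨
    length (X₁ ++ X₂)  ≤⟨ unique-⊆-length (Unique.++⁺ uX₁ uX₂ (λ (i , j) → X₁#X₂ _ i j)) (λ x → from (cover x) ∘ to ++-∈⇔) ⟩
    length X′          ≡⟨ |X′|≡d ⟩
    d                  ≤⟨ disagreement-size T₁ T₂ same dlr Y₁ Y₂ ldY ⟩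
    ldSize Y₁ Y₂       ∎
  where open ≤-Reasoning

lemma2 : (T₁ T₂ : Tree) → Phylo (just T₁) → Phylo (just T₂)
    → SameLabels (just T₁) (just T₂)
    → (d : ℕ) → IsDLR (just T₁) (just T₂) d
    → ((Σ (List ℕ) λ X₁ → Σ (List ℕ) λ X₂ →
          LeafDisagreement (just T₁) (just T₂) X₁ X₂ × ldSize X₁ X₂ ≡ d)
       × (∀ X₁ X₂ → LeafDisagreement (just T₁) (just T₂) X₁ X₂ → d ≤ ldSize X₁ X₂))
      × (∀ X₁ X₂ → OptimalLD (just T₁) (just T₂) X₁ X₂ ⇔
          (Σ (List ℕ) λ X′ → AgreementSet (just T₁) (just T₂) X′
             × length X′ ≡ d × PartitionOf X′ X₁ X₂))
lemma2 T₁ T₂ u₁ u₂ same d dlr =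
  (minimum-disagreement (just T₁) (just T₂) u₁ u₂ dlr , disagreement-size (just T₁) (just T₂) same dlr) ,
  λ X₁ X₂ → mk⇔ (optimal⇒partition (just T₁) (just T₂) u₁ u₂ same dlr X₁ X₂)
                (partition⇒optimal (just T₁) (just T₂) u₁ u₂ same dlr X₁ X₂)
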